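{- Let $A$ be an $n\times n$ matrix with entries in $\{0,1\}$. Then for every field $\mathbb{F}$, $\mathrm{rk}_{\mathbb{F}}(A)\geq \mathrm{rk}_{\mathbb{S}}(A)$.
   Context: $\mathrm{rk}_{\mathbb{F}}(A)$ is the usual rank of $A$ regarded as a matrix over $\mathbb{F}$ (with $0,1$ the zero and unit of $\mathbb{F}$). The superboolean semiring $\mathbb{S}=\{0,1,1^\nu\}$ has $0+x=x$, $1+1=1^\nu$, $1+1^\nu=1^\nu+1^\nu=1^\nu$, $0\cdot x=0$, $1\cdot x=x$, $1^\nu\cdot 1^\nu=1^\nu$; the ghost elements are $\{0,1^\nu\}$. Vectors $v_1,\dots,v_k\in\mathbb{S}^{m}$ are dependent if there exist $\alpha_1,\dots,\alpha_k\in\{0,1\}$, not all $0$, with $\alpha_1v_1+\cdots+\alpha_kv_k\in\{0,1^\nu\}^{m}$ (coordinatewise operations in $\mathbb{S}$), and independent otherwise. $\mathrm{rk}_{\mathbb{S}}(A)$ is the maximal number of independent columns of $A$ (viewed in $\mathbb{S}$). -}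

module Defs where

open import Level using (Level; _⊔_; suc)
open import Data.Nat using (ℕ; zero; _≤_) renaming (suc to sucℕ)
open import Data.Fin using (Fin) renaming (zero to fz; suc to fs)
open import Data.Bool using (Bool; true; false; if_then_else_)
open import Data.Product using (Σ; ∃; _×_; _,_)
open import Relation.Nullary using (¬_)
open import Relation.Binary.PropositionalEquality using (_≡_)
open import Function.Definitions using (Injective)
open import Algebra.Bundles using (CommutativeRing)

record Field (c ℓ : Level) : Set (suc (c ⊔ ℓ)) where
  field
    commutativeRing : CommutativeRing c ℓ
  open CommutativeRing commutativeRing public
  field
    0≉1     : ¬ (0# ≈ 1#)
    inverse : ∀ x → ¬ (x ≈ 0#) → Σ Carrier λ y → (x * y) ≈ 1#

-- 0/1 matrices (n × n), entries as Bool: false = 0, true = 1.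
-- A i j is the entry in row i, column j.

Matrix01 : ℕ → Set
Matrix01 n = Fin n → Fin n → Bool

ColumnChoice : ℕ → ℕ → Set
ColumnChoice k n = Σ (Fin k → Fin n) λ f → Injective _≡_ _≡_ f

module _ {c ℓ} (F : Field c ℓ) where
  open Field F

  embF : Bool → Carrier
  embF false = 0#
  embF true  = 1#

  sumF : ∀ {k} → (Fin k → Carrier) → Carrier
  sumF {zero}   v = 0#
  sumF {sucℕ k} v = v fz + sumF (λ j → v (fs j))

  IndependentF : ∀ {n k} → Matrix01 n → (Fin k → Fin n) → Set (c ⊔ ℓ)
  IndependentF {n} {k} A f =
    (α : Fin k → Carrier) →
    (∀ i → sumF (λ j → α j * embF (A i (f j))) ≈ 0#) →
    ∀ j → α j ≈ 0#

  IsRankF : ∀ {n} → Matrix01 n → ℕ → Set (c ⊔ ℓ)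
  IsRankF {n} A r =
    (Σ (ColumnChoice r n) λ { (f , _) → IndependentF A f }) ×
    (∀ k → (cf : ColumnChoice k n) → IndependentF A (Data.Product.proj₁ cf) → k ≤ r)

data 𝕊 : Set where
  𝟘 𝟙 𝟙ν : 𝕊

infixl 6 _+𝕊_
infixl 7 _*𝕊_

_+𝕊_ : 𝕊 → 𝕊 → 𝕊
𝟘  +𝕊 y  = y
𝟙  +𝕊 𝟘  = 𝟙
𝟙  +𝕊 𝟙  = 𝟙ν
𝟙  +𝕊 𝟙ν = 𝟙ν
𝟙ν +𝕊 _  = 𝟙ν

_*𝕊_ : 𝕊 → 𝕊 → 𝕊
𝟘  *𝕊 _  = 𝟘
𝟙  *𝕊 y  = y
𝟙ν *𝕊 𝟘  = 𝟘
𝟙ν *𝕊 𝟙  = 𝟙ν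
𝟙ν *𝕊 𝟙ν = 𝟙ν

data Ghost : 𝕊 → Set where
  ghost𝟘  : Ghost 𝟘
  ghost𝟙ν : Ghost 𝟙ν

embS : Bool → 𝕊
embS false = 𝟘
embS true  = 𝟙

sum𝕊 : ∀ {k} → (Fin k → 𝕊) → 𝕊
sum𝕊 {zero}   v = 𝟘
sum𝕊 {sucℕ k} v = v fz +𝕊 sum𝕊 (λ j → v (fs j))

DependentS : ∀ {n k} → Matrix01 n → (Fin k → Fin n) → Set
DependentS {n} {k} A f =
  Σ (Fin k → Bool) λ α →
    (∃ λ j → α j ≡ true) ×
    (∀ i → Ghost (sum𝕊 (λ j → embS (α j) *𝕊 embS (A i (f j)))))

IndependentS : ∀ {n k} → Matrix01 n → (Fin k → Fin n) → Set
IndependentS A f = ¬ DependentS A f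

IsRankS : ∀ {n} → Matrix01 n → ℕ → Set
IsRankS {n} A r =
  (Σ (ColumnChoice r n) λ { (f , _) → IndependentS A f }) ×
  (∀ k → (cf : ColumnChoice k n) → IndependentS A (Data.Product.proj₁ cf) → k ≤ r)

-- Independent columns over 𝕊 are independent over every field. If columns
-- are 𝕊-independent, the all-ones combination is not ghost, so some row
-- meets exactly one of the columns, say j. A vanishing F-combination then
-- has coefficient 0 at j on that row; dropping column j leaves an
-- 𝕊-independent family and an F-combination of it that still vanishes, so
-- induction on the number of columns kills every coefficient. Hence any
-- 𝕊-independent choice of rk_𝕊(A) columns is F-independent.
module Submission where

open import Defs
open import Level using (Level)
open import Algebra.Bundles using (CommutativeMonoid)
open import Data.Nat using (ℕ; _≥_; zero; suc)
open import Data.Fin using (Fin; _≟_; punchIn) renaming (zero to fz; suc to fs)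
open import Data.Fin.Properties using (¬∀⟶∃¬; punchIn-punchOut)
open import Data.Bool using (Bool; true; false)
open import Data.Product using (∃; ∃₂; _×_; _,_; proj₁; proj₂)
open import Data.Sum using (_⊎_; inj₁; inj₂)
open import Data.Vec.Functional using (insertAt; removeAt; replicate)
open import Data.Vec.Functional.Properties using (insertAt-lookup; insertAt-punchIn)
open import Function using (_∘_)
open import Relation.Nullary using (¬_; Dec; yes; no)
open import Relation.Binary.PropositionalEquality
  using (_≡_; refl; sym; trans; cong; cong₂; subst; isEquivalence; module ≡-Reasoning)

punchIn-∀ : ∀ {p k} {P : Fin (suc k) → Set p} (i : Fin (suc k)) →
            P i → (∀ j → P (punchIn i j)) → ∀ j → P j
punchIn-∀ {P = P} i Pi P↑ j with i ≟ j
... | yes refl = Pi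
... | no i≢j   = subst P (punchIn-punchOut i≢j) (P↑ _)

module CommutativeMonoidSum {a ℓ} (M : CommutativeMonoid a ℓ) where
  open CommutativeMonoid M renaming (ε to 0#; _∙_ to _+_)
  open import Algebra.Properties.CommutativeMonoid.Sum M public
  open import Relation.Binary.Reasoning.Setoid setoid

  sum-removeAt-zero : ∀ {k} (t : Fin (suc k) → Carrier) i →
                      t i ≈ 0# → sum t ≈ sum (removeAt t i)
  sum-removeAt-zero t i ti≈0 = begin
    sum t                        ≈⟨ sum-remove t ⟩
    t i + sum (removeAt t i)     ≈⟨ ∙-congʳ ti≈0 ⟩
    0# + sum (removeAt t i)      ≈⟨ identityˡ _ ⟩
    sum (removeAt t i)           ∎

  sum-concentrated : ∀ {k} (t : Fin (suc k) → Carrier) i →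
                     (∀ j → removeAt t i j ≈ 0#) → sum t ≈ t i
  sum-concentrated {k} t i others≈0 = begin
    sum t                        ≈⟨ sum-remove t ⟩
    t i + sum (removeAt t i)     ≈⟨ ∙-congˡ (sum-cong-≋ others≈0) ⟩
    t i + sum (replicate k 0#)   ≈⟨ ∙-congˡ (sum-replicate-zero k) ⟩
    t i + 0#                     ≈⟨ identityʳ _ ⟩
    t i                          ∎

+𝕊-identityʳ : ∀ x → x +𝕊 𝟘 ≡ x
+𝕊-identityʳ 𝟘  = refl
+𝕊-identityʳ 𝟙  = refl
+𝕊-identityʳ 𝟙ν = refl

+𝕊-comm : ∀ x y → x +𝕊 y ≡ y +𝕊 x
+𝕊-comm 𝟘  y  = sym (+𝕊-identityʳ y)
+𝕊-comm x  𝟘  = +𝕊-identityʳ x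
+𝕊-comm 𝟙  𝟙  = refl
+𝕊-comm 𝟙  𝟙ν = refl
+𝕊-comm 𝟙ν 𝟙  = refl
+𝕊-comm 𝟙ν 𝟙ν = refl

+𝕊-assoc : ∀ x y z → (x +𝕊 y) +𝕊 z ≡ x +𝕊 (y +𝕊 z)
+𝕊-assoc 𝟘  y  z  = refl
+𝕊-assoc 𝟙  𝟘  z  = refl
+𝕊-assoc 𝟙  𝟙  𝟘  = refl
+𝕊-assoc 𝟙  𝟙  𝟙  = refl
+𝕊-assoc 𝟙  𝟙  𝟙ν = refl
+𝕊-assoc 𝟙  𝟙ν z  = refl
+𝕊-assoc 𝟙ν y  z  = refl

+𝕊-commutativeMonoid : CommutativeMonoid _ _
+𝕊-commutativeMonoid = record
  { Carrier             = 𝕊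
  ; _≈_                 = _≡_
  ; _∙_                 = _+𝕊_
  ; ε                   = 𝟘
  ; isCommutativeMonoid = record
    { isMonoid = record
      { isSemigroup = record
        { isMagma = record { isEquivalence = isEquivalence ; ∙-cong = cong₂ _+𝕊_ }
        ; assoc   = +𝕊-assoc
        }
      ; identity = (λ _ → refl) , +𝕊-identityʳ
      }
    ; comm = +𝕊-comm
    }
  }

ghost? : ∀ s → Dec (Ghost s)
ghost? 𝟘  = yes ghost𝟘
ghost? 𝟙  = no λ ()
ghost? 𝟙ν = yes ghost𝟙ν

¬Ghost⇒≡𝟙 : ∀ {s} → ¬ Ghost s → s ≡ 𝟙
¬Ghost⇒≡𝟙 {𝟘}  ¬ghost with () ← ¬ghost ghost𝟘
¬Ghost⇒≡𝟙 {𝟙}  _      = refl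
¬Ghost⇒≡𝟙 {𝟙ν} ¬ghost with () ← ¬ghost ghost𝟙ν

embS≡𝟘⇒false : ∀ {b} → embS b ≡ 𝟘 → b ≡ false
embS≡𝟘⇒false {false} _ = refl

embS≡𝟙⇒true : ∀ {b} → embS b ≡ 𝟙 → b ≡ true
embS≡𝟙⇒true {true} _ = refl

+𝕊≡𝟘⇒both≡𝟘 : ∀ {x y} → x +𝕊 y ≡ 𝟘 → x ≡ 𝟘 × y ≡ 𝟘
+𝕊≡𝟘⇒both≡𝟘 {𝟘} y≡𝟘 = refl , y≡𝟘
+𝕊≡𝟘⇒both≡𝟘 {𝟙} {𝟘} ()

+𝕊≡𝟙⇒one≡𝟙 : ∀ {x y} → x +𝕊 y ≡ 𝟙 → (x ≡ 𝟙 × y ≡ 𝟘) ⊎ (x ≡ 𝟘 × y ≡ 𝟙)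
+𝕊≡𝟙⇒one≡𝟙 {𝟘}      y≡𝟙 = inj₂ (refl , y≡𝟙)
+𝕊≡𝟙⇒one≡𝟙 {𝟙} {𝟘}  _   = inj₁ (refl , refl)

sum𝕊-embS≡𝟘⇒false : ∀ {k} (b : Fin k → Bool) → sum𝕊 (embS ∘ b) ≡ 𝟘 → ∀ j → b j ≡ false
sum𝕊-embS≡𝟘⇒false b s≡𝟘 fz     = embS≡𝟘⇒false (proj₁ (+𝕊≡𝟘⇒both≡𝟘 s≡𝟘))
sum𝕊-embS≡𝟘⇒false b s≡𝟘 (fs j) = sum𝕊-embS≡𝟘⇒false (b ∘ fs) (proj₂ (+𝕊≡𝟘⇒both≡𝟘 s≡𝟘)) j

sum𝕊-embS≡𝟙⇒single : ∀ {k} (b : Fin (suc k) → Bool) → sum𝕊 (embS ∘ b) ≡ 𝟙 →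
                      ∃ λ j → b j ≡ true × (∀ j′ → removeAt b j j′ ≡ false)
sum𝕊-embS≡𝟙⇒single b s≡𝟙 with +𝕊≡𝟙⇒one≡𝟙 s≡𝟙
... | inj₁ (b₀≡𝟙 , rest≡𝟘) = fz , embS≡𝟙⇒true b₀≡𝟙 , sum𝕊-embS≡𝟘⇒false (b ∘ fs) rest≡𝟘
sum𝕊-embS≡𝟙⇒single {suc k} b s≡𝟙 | inj₂ (b₀≡𝟘 , rest≡𝟙) with sum𝕊-embS≡𝟙⇒single (b ∘ fs) rest≡𝟙
...   | j , bj , others = fs j , bj , λ { fz → embS≡𝟘⇒false b₀≡𝟘 ; (fs j′) → others j′ }

module _ {n} (A : Matrix01 n) where

  independentS⇒isolatingRow : ∀ {k} (f : Fin (suc k) → Fin n) → IndependentS A f →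
    ∃₂ λ i j → A i (f j) ≡ true × (∀ j′ → A i (f (punchIn j j′)) ≡ false)
  independentS⇒isolatingRow f indS
    with ¬∀⟶∃¬ n (Ghost ∘ rowSum) (ghost? ∘ rowSum) (λ ghosts → indS ((λ _ → true) , (fz , refl) , ghosts))
    where
    rowSum : Fin n → 𝕊
    rowSum i = sum𝕊 (λ j → embS (A i (f j)))
  ... | i , ¬ghost = i , sum𝕊-embS≡𝟙⇒single (λ j → A i (f j)) (¬Ghost⇒≡𝟙 ¬ghost)

  independentS-removeAt : ∀ {k} (f : Fin (suc k) → Fin n) (j : Fin (suc k)) →
                          IndependentS A f → IndependentS A (removeAt f j)
  independentS-removeAt {k} f j indS (β , (j′ , βj′) , ghosts) =
    indS (β⁺ , (punchIn j j′ , trans (insertAt-punchIn β j false j′) βj′) ,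
          λ i → subst Ghost (sym (row-removeAt i)) (ghosts i))
    where
    open CommutativeMonoidSum +𝕊-commutativeMonoid using (sum; sum-cong-≗; sum-removeAt-zero)
    open ≡-Reasoning

    sum𝕊≡sum : ∀ {m} (v : Fin m → 𝕊) → sum𝕊 v ≡ sum v
    sum𝕊≡sum {zero}  v = refl
    sum𝕊≡sum {suc m} v = cong (v fz +𝕊_) (sum𝕊≡sum (v ∘ fs))

    β⁺ : Fin (suc k) → Bool
    β⁺ = insertAt β j false
    term : Fin n → Fin (suc k) → 𝕊
    term i l = embS (β⁺ l) *𝕊 embS (A i (f l))
    term′ : Fin n → Fin k → 𝕊
    term′ i l = embS (β l) *𝕊 embS (A i (removeAt f j l))

    row-removeAt : ∀ i → sum𝕊 (term i) ≡ sum𝕊 (term′ i)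
    row-removeAt i = begin
      sum𝕊 (term i)                   ≡⟨ sum𝕊≡sum (term i) ⟩
      sum (term i)                    ≡⟨ sum-removeAt-zero (term i) j
                                           (cong (λ b → embS b *𝕊 embS (A i (f j))) (insertAt-lookup β j false)) ⟩
      sum (removeAt (term i) j)       ≡⟨ sum-cong-≗ (λ l → cong (λ b → embS b *𝕊 embS (A i (removeAt f j l)))
                                                               (insertAt-punchIn β j false l)) ⟩
      sum (term′ i)                   ≡⟨ sym (sum𝕊≡sum (term′ i)) ⟩
      sum𝕊 (term′ i)                  ∎

module _ {c ℓ} (F : Field c ℓ) where
  open Field F hiding (refl; sym) renaming (trans to ≈-trans)
  open CommutativeMonoidSum +-commutativeMonoid
    using (sum; sum-removeAt-zero; sum-concentrated)
  open import Relation.Binary.Reasoning.Setoid setoid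

  sumF≡sum : ∀ {k} (v : Fin k → Carrier) → sumF F v ≡ sum v
  sumF≡sum {zero}  v = refl
  sumF≡sum {suc k} v = cong (v fz +_) (sumF≡sum (v ∘ fs))

  independentS⇒independentF : ∀ {n k} (A : Matrix01 n) (f : Fin k → Fin n) →
                              IndependentS A f → IndependentF F A f
  independentS⇒independentF {k = zero}    A f _    _ _ ()
  independentS⇒independentF {n} {suc k} A f indS α combination≈0
    with independentS⇒isolatingRow A f indS
  ... | i , j , Aij≡1 , Ai-others≡0 =
    punchIn-∀ j αj≈0
      (independentS⇒independentF A (removeAt f j) (independentS-removeAt A f j indS) (removeAt α j) removed≈0)
    where
    term : Fin n → Fin (suc k) → Carrier
    term i′ l = α l * embF F (A i′ (f l))

    αj≈0 : α j ≈ 0#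
    αj≈0 = begin
      α j                ≈⟨ *-identityʳ (α j) ⟨
      α j * 1#           ≡⟨ cong (λ b → α j * embF F b) Aij≡1 ⟨
      term i j           ≈⟨ sum-concentrated (term i) j others≈0 ⟨
      sum (term i)       ≡⟨ sumF≡sum (term i) ⟨
      sumF F (term i)    ≈⟨ combination≈0 i ⟩
      0#                 ∎
      where
      others≈0 : ∀ l → removeAt (term i) j l ≈ 0#
      others≈0 l = ≈-trans (*-congˡ (reflexive (cong (embF F) (Ai-others≡0 l)))) (zeroʳ _)

    removed≈0 : ∀ i′ → sumF F (removeAt (term i′) j) ≈ 0#
    removed≈0 i′ = begin
      sumF F (removeAt (term i′) j)  ≡⟨ sumF≡sum (removeAt (term i′) j) ⟩
      sum (removeAt (term i′) j)     ≈⟨ sum-removeAt-zero (term i′) j (≈-trans (*-congʳ αj≈0) (zeroˡ _)) ⟨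
      sum (term i′)                  ≡⟨ sumF≡sum (term i′) ⟨
      sumF F (term i′)               ≈⟨ combination≈0 i′ ⟩
      0#                             ∎

proposition3p18 : ∀ {c ℓ : Level} (F : Field c ℓ) (n : ℕ) (A : Matrix01 n) (rF rS : ℕ) →
    IsRankF F A rF → IsRankS A rS → rF ≥ rS
proposition3p18 F n A rF rS (_ , maximalF) ((columns , indS) , _) =
  maximalF rS columns (independentS⇒independentF F A (proj₁ columns) indS)
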